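{- Let $n,k,d$ be positive integers and suppose the graph $nK_2$ is $(k,d)$-hooked Skolem graceful. Then: (1) if $n\equiv 1 \pmod 4$, then $k$ is even; (2) if $n\equiv 2 \pmod 4$, then $d$ is odd; (3) if $n\equiv 3 \pmod 4$, then $k$ and $d$ are either both even or both odd.
   Context: $nK_2$ denotes the disjoint union of $n$ copies of $K_2$ (so it has $2n$ vertices and $n$ edges). A graph $G=(V,E)$ with $p$ vertices and $q$ edges is called $(k,d)$-hooked Skolem graceful (for positive integers $k,d$) if there is a bijection $f:V\to\{1,2,\dots,p-1,p+1\}$ such that the induced edge labeling $g_f:E\to\{k,k+d,k+2d,\dots,k+(q-1)d\}$ given by $g_f(uv)=|f(u)-f(v)|$ for all $uv\in E$ is a bijection. -}

module Defs where

open import Data.Nat using (ℕ; zero; suc; _+_; _*_; _∸_; _≤_; _<_)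
open import Data.Nat using () renaming (∣_-_∣ to dist)
open import Data.Fin using (Fin; toℕ; _↑ˡ_; _↑ʳ_)
open import Data.Product using (Σ; _×_; _,_; ∃; proj₁; proj₂)
open import Data.Sum using (_⊎_)
open import Relation.Binary.PropositionalEquality using (_≡_)
open import Function.Definitions using (Injective)

record Graph : Set where
  field
    p : ℕ
    q : ℕ
    ends : Fin q → Fin p × Fin p

open Graph public

InVertexLabels : ℕ → ℕ → Set
InVertexLabels p x = (1 ≤ x × x ≤ p ∸ 1) ⊎ x ≡ suc p

InEdgeLabels : ℕ → ℕ → ℕ → ℕ → Set
InEdgeLabels k d q y = Σ ℕ λ j → j < q × y ≡ k + j * d

edgeLabel : (G : Graph) → (Fin (p G) → ℕ) → Fin (q G) → ℕ
edgeLabel G f e = dist (f (proj₁ (ends G e))) (f (proj₂ (ends G e)))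

HookedSkolemGraceful : ℕ → ℕ → Graph → Set
HookedSkolemGraceful k d G =
  Σ (Fin (p G) → ℕ) λ f →
    ( Injective _≡_ _≡_ f
    × (∀ v → InVertexLabels (p G) (f v))
    × (∀ x → InVertexLabels (p G) x → Σ (Fin (p G)) λ v → f v ≡ x) )
  × ( Injective _≡_ _≡_ (edgeLabel G f)
    × (∀ e → InEdgeLabels k d (q G) (edgeLabel G f e))
    × (∀ y → InEdgeLabels k d (q G) y → Σ (Fin (q G)) λ e → edgeLabel G f e ≡ y) )

-- nK₂: vertices Fin (n + n); edge i (i : Fin n) joins vertex i and vertex n + i.
-- This is n disjoint copies of K₂ (2n vertices, n edges).
nK₂ : ℕ → Graph
nK₂ n = record
  { p = n + n
  ; q = n
  ; ends = λ i → i ↑ˡ n , n ↑ʳ i }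

-- Sum all labels mod 2. An edge label |f u - f v| has the parity of f u + f v, and the
-- edges of nK₂ partition its vertices, so the edge labels k, k + d, …, k + (n-1)d and
-- the vertex labels 1, …, 2n-1, 2n+1 have sums of equal parity. The vertex sum is
-- n(2n-1) + 2n + 1 ≡ n + 1, while the parity of the edge sum depends only on n mod 4
-- (four consecutive terms of a progression sum to an even number); comparing the two
-- for n ≡ 1, 2, 3 (mod 4) gives the three conditions on k and d.
module Submission where

open import Defs
open import Data.Nat using (ℕ; zero; suc; _+_; _*_; _%_; _<_; z≤n; s≤s; NonZero; parity)
open import Data.Nat using () renaming (∣_-_∣ to dist)
open import Data.Nat.Properties using (+-suc; +-assoc; +-comm; +-cancelˡ-≡; *-cancelʳ-≡; suc-injective; m+n≮n; +-0-commutativeMonoid)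
open import Data.Nat.DivMod using (_/_; m≡m%n+[m/n]*n)
open import Data.Nat.Divisibility using (_∣_; divides)
open import Data.Parity.Base as ℙ using (Parity; 0ℙ; 1ℙ; _⁻¹)
import Data.Parity.Properties as ℙ
open import Data.Fin using (Fin; toℕ; fromℕ<; _↑ˡ_; _↑ʳ_) renaming (zero to fzero; suc to fsuc)
open import Data.Fin.Properties using (toℕ<n; toℕ-fromℕ<; toℕ-injective)
open import Data.Fin.Permutation using (permutation)
open import Data.Product using (Σ; _×_; _,_; proj₁; proj₂)
open import Data.Sum using (_⊎_; inj₁; inj₂)
open import Data.Empty using (⊥-elim)
open import Function using (_∘_)
open import Function.Definitions using (Injective)
open import Relation.Binary.PropositionalEquality using (_≡_; refl; sym; trans; cong; cong₂; subst; module ≡-Reasoning)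
open import Relation.Nullary using (¬_)
open import Algebra.Properties.CommutativeMonoid.Sum +-0-commutativeMonoid
  using (sum; sum-permute; sum-cong-≗; ∑-distrib-+)
import Algebra.Properties.Monoid.Sum ℙ.+-0-monoid as ℙΣ

open ≡-Reasoning

periodic⇒≡% : ∀ {A : Set} q .{{_ : NonZero q}} (P : ℕ → A) →
  (∀ m → P (q + m) ≡ P m) → ∀ n → P n ≡ P (n % q)
periodic⇒≡% q P periodic n = begin
  P n                     ≡⟨ cong P (trans (m≡m%n+[m/n]*n n q) (+-comm (n % q) _)) ⟩
  P (n / q * q + n % q)   ≡⟨ shift (n / q) (n % q) ⟩
  P (n % q)               ∎
  where
  shift : ∀ t r → P (t * q + r) ≡ P r
  shift zero    r = refl
  shift (suc t) r = trans (cong P (+-assoc q (t * q) r)) (trans (periodic _) (shift t r))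

parity≡0ℙ⇒2∣ : ∀ {n} → parity n ≡ 0ℙ → 2 ∣ n
parity≡0ℙ⇒2∣ {zero}        _  = divides 0 refl
parity≡0ℙ⇒2∣ {suc (suc n)} eq with parity≡0ℙ⇒2∣ {n} eq
... | divides q n≡q*2 = divides (suc q) (cong (suc ∘ suc) n≡q*2)

parity≡1ℙ⇒2∤ : ∀ {n} → parity n ≡ 1ℙ → ¬ 2 ∣ n
parity≡1ℙ⇒2∤ eq (divides q refl)
  with trans (sym eq) (trans (ℙ.*-homo-* q 2) (ℙ.*-zeroʳ (parity q)))
... | ()

sameParity⇒2∣⊎2∤ : ∀ {m n} → parity m ≡ parity n →
  (2 ∣ m × 2 ∣ n) ⊎ (¬ 2 ∣ m × ¬ 2 ∣ n)
sameParity⇒2∣⊎2∤ {m} eq with parity m in pm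
... | 0ℙ = inj₁ (parity≡0ℙ⇒2∣ pm , parity≡0ℙ⇒2∣ (sym eq))
... | 1ℙ = inj₂ (parity≡1ℙ⇒2∤ pm , parity≡1ℙ⇒2∤ (sym eq))

parity-∣-∣ : ∀ m n → parity (dist m n) ≡ parity (m + n)
parity-∣-∣ zero    n       = refl
parity-∣-∣ (suc m) zero    = cong (parity ∘ suc) (sym (+-comm m 0))
parity-∣-∣ (suc m) (suc n) = trans (parity-∣-∣ m n) (cong (parity ∘ suc) (sym (+-suc m n)))

parity-suc-double : ∀ n → parity (suc (n + n)) ≡ 1ℙ
parity-suc-double zero    = refl
parity-suc-double (suc n) = trans (cong parity (+-suc n n)) (parity-suc-double n)

parity-sum : ∀ {m} (f : Fin m → ℕ) → parity (sum f) ≡ ℙΣ.sum (parity ∘ f)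
parity-sum {zero}  f = refl
parity-sum {suc m} f =
  trans (ℙ.+-homo-+ (f fzero) _) (cong (parity (f fzero) ℙ.+_) (parity-sum (f ∘ fsuc)))

parity-sum-cong : ∀ {m} {f g : Fin m → ℕ} → (∀ i → parity (f i) ≡ parity (g i)) →
  parity (sum f) ≡ parity (sum g)
parity-sum-cong {f = f} {g} eq =
  trans (parity-sum f) (trans (ℙΣ.sum-cong-≗ eq) (sym (parity-sum g)))

sum-↑ˡ-↑ʳ : ∀ m n (f : Fin (m + n) → ℕ) →
  sum f ≡ sum (λ i → f (i ↑ˡ n)) + sum (λ i → f (m ↑ʳ i))
sum-↑ˡ-↑ʳ zero    n f = refl
sum-↑ˡ-↑ʳ (suc m) n f =
  trans (cong (f fzero +_) (sum-↑ˡ-↑ʳ m n (f ∘ fsuc))) (sym (+-assoc (f fzero) _ _))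

parity-sum-toℕ-double : ∀ n → ℙΣ.sum {n + n} (parity ∘ toℕ) ≡ parity n
parity-sum-toℕ-double zero    = refl
parity-sum-toℕ-double (suc n) = begin
  ℙΣ.sum {suc n + suc n} (parity ∘ toℕ)      ≡⟨ cong (λ l → ℙΣ.sum {suc l} (parity ∘ toℕ)) (+-suc n n) ⟩
  ℙΣ.sum {suc (suc (n + n))} (parity ∘ toℕ)  ≡⟨⟩
  ℙΣ.sum {n + n} (parity ∘ toℕ) ⁻¹           ≡⟨ cong _⁻¹ (parity-sum-toℕ-double n) ⟩
  parity n ⁻¹                                ≡⟨ ℙ.suc-homo-⁻¹ (suc n) ⟩
  parity (suc n)                             ∎

BijectiveOnto : ∀ {m} → (ℕ → Set) → (Fin m → ℕ) → Set
BijectiveOnto {m} P f =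
  Injective _≡_ _≡_ f × (∀ v → P (f v)) × (∀ x → P x → Σ (Fin m) λ v → f v ≡ x)

sum-bijectiveOnto : ∀ {m P} {f g : Fin m → ℕ} →
  BijectiveOnto P f → BijectiveOnto P g → sum f ≡ sum g
sum-bijectiveOnto {f = f} {g} (f-inj , f∈P , f-onto) (g-inj , g∈P , g-onto) =
  trans (sum-permute f (permutation σ π σ∘π π∘σ)) (sum-cong-≗ λ i → proj₂ (f-onto (g i) (g∈P i)))
  where
  σ = λ i → proj₁ (f-onto (g i) (g∈P i))
  π = λ v → proj₁ (g-onto (f v) (f∈P v))
  σ∘π : ∀ v → σ (π v) ≡ v
  σ∘π v = f-inj (trans (proj₂ (f-onto _ (g∈P (π v)))) (proj₂ (g-onto (f v) (f∈P v))))
  π∘σ : ∀ i → π (σ i) ≡ i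
  π∘σ i = g-inj (trans (proj₂ (g-onto _ (f∈P (σ i)))) (proj₂ (f-onto (g i) (g∈P i))))

-- The label p + 1 takes the place of 0 in the enumeration 0, 1, …, p - 1.
hookedLabel : ℕ → ℕ → ℕ
hookedLabel p zero    = suc p
hookedLabel p (suc j) = suc j

hookedLabel-bijectiveOnto : ∀ p →
  BijectiveOnto (InVertexLabels (suc p)) (hookedLabel (suc p) ∘ toℕ)
hookedLabel-bijectiveOnto p = injective , inLabels , onto
  where
  injective : Injective _≡_ _≡_ (hookedLabel (suc p) ∘ toℕ)
  injective {fzero}  {fzero}  _  = refl
  injective {fzero}  {fsuc j} eq = ⊥-elim (m+n≮n 1 p (subst (_< p) (sym (suc-injective eq)) (toℕ<n j)))
  injective {fsuc i} {fzero}  eq = ⊥-elim (m+n≮n 1 p (subst (_< p) (suc-injective eq) (toℕ<n i)))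
  injective {fsuc i} {fsuc j} eq = cong fsuc (toℕ-injective (suc-injective eq))
  inLabels : ∀ i → InVertexLabels (suc p) (hookedLabel (suc p) (toℕ i))
  inLabels fzero    = inj₂ refl
  inLabels (fsuc i) = inj₁ (s≤s z≤n , toℕ<n i)
  onto : ∀ x → InVertexLabels (suc p) x → Σ (Fin (suc p)) λ i → hookedLabel (suc p) (toℕ i) ≡ x
  onto x       (inj₂ refl)             = fzero , refl
  onto (suc x) (inj₁ (s≤s z≤n , x<p)) = fsuc (fromℕ< x<p) , cong suc (toℕ-fromℕ< x<p)

-- Definitionally, the hooked labels sum to (m + 1) + (0 + 1 + … + (m - 1)).
parity-sum-hookedLabel : ∀ n →
  parity (sum {suc n + suc n} (hookedLabel (suc n + suc n) ∘ toℕ)) ≡ parity (suc n) ⁻¹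
parity-sum-hookedLabel n = begin
  parity (suc m + sum {m} toℕ)
    ≡⟨ ℙ.+-homo-+ (suc m) (sum {m} toℕ) ⟩
  parity (suc m) ℙ.+ parity (sum {m} toℕ)
    ≡⟨ cong₂ ℙ._+_ (parity-suc-double (suc n)) (trans (parity-sum {m} toℕ) (parity-sum-toℕ-double (suc n))) ⟩
  parity (suc n) ⁻¹
    ∎
  where m = suc n + suc n

progression-bijectiveOnto : ∀ k d .{{_ : NonZero d}} q →
  BijectiveOnto (InEdgeLabels k d q) (λ (i : Fin q) → k + toℕ i * d)
progression-bijectiveOnto k d q =
    (λ {i} {j} eq → toℕ-injective (*-cancelʳ-≡ (toℕ i) (toℕ j) d (+-cancelˡ-≡ k _ _ eq)))
  , (λ i → toℕ i , toℕ<n i , refl)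
  , λ { _ (j , j<q , refl) → fromℕ< j<q , cong (λ t → k + t * d) (toℕ-fromℕ< j<q) }

progressionParity : Parity → Parity → ℕ → Parity
progressionParity a b m = ℙΣ.sum {m} λ i → a ℙ.+ (parity (toℕ i) ℙ.* b)

parity-sum-progression : ∀ k d m →
  parity (sum {m} λ i → k + toℕ i * d) ≡ progressionParity (parity k) (parity d) m
parity-sum-progression k d m = trans (parity-sum {m} λ i → k + toℕ i * d) (ℙΣ.sum-cong-≗ {m} λ i →
  trans (ℙ.+-homo-+ k (toℕ i * d)) (cong (parity k ℙ.+_) (ℙ.*-homo-* (toℕ i) d)))

p+[q+[p+[q+r]]]≡r : ∀ p q r → p ℙ.+ (q ℙ.+ (p ℙ.+ (q ℙ.+ r))) ≡ r
p+[q+[p+[q+r]]]≡r 0ℙ 0ℙ r = refl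
p+[q+[p+[q+r]]]≡r 0ℙ 1ℙ r = ℙ.⁻¹-involutive r
p+[q+[p+[q+r]]]≡r 1ℙ 0ℙ r = ℙ.⁻¹-involutive r
p+[q+[p+[q+r]]]≡r 1ℙ 1ℙ r = trans (cong (_⁻¹ ∘ _⁻¹) (ℙ.⁻¹-involutive r)) (ℙ.⁻¹-involutive r)

progressionParity-periodic : ∀ a b m → progressionParity a b (4 + m) ≡ progressionParity a b m
progressionParity-periodic a b m = p+[q+[p+[q+r]]]≡r (a ℙ.+ 0ℙ) (a ℙ.+ b) (progressionParity a b m)

progressionParity-1 : ∀ a b → progressionParity a b 1 ≡ parity 1 ⁻¹ → a ≡ 0ℙ
progressionParity-1 0ℙ _ _ = refl
progressionParity-1 1ℙ _ ()

progressionParity-2 : ∀ a b → progressionParity a b 2 ≡ parity 2 ⁻¹ → b ≡ 1ℙ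
progressionParity-2 0ℙ 1ℙ _ = refl
progressionParity-2 1ℙ 1ℙ _ = refl
progressionParity-2 0ℙ 0ℙ ()
progressionParity-2 1ℙ 0ℙ ()

progressionParity-3 : ∀ a b → progressionParity a b 3 ≡ parity 3 ⁻¹ → a ≡ b
progressionParity-3 0ℙ 0ℙ _ = refl
progressionParity-3 1ℙ 1ℙ _ = refl
progressionParity-3 0ℙ 1ℙ ()
progressionParity-3 1ℙ 0ℙ ()

parity-sum-edgeLabel-nK₂ : ∀ n (f : Fin (n + n) → ℕ) →
  parity (sum (edgeLabel (nK₂ n) f)) ≡ parity (sum f)
parity-sum-edgeLabel-nK₂ n f = begin
  parity (sum (edgeLabel (nK₂ n) f))
    ≡⟨ parity-sum-cong (λ i → parity-∣-∣ (f (i ↑ˡ n)) (f (n ↑ʳ i))) ⟩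
  parity (sum λ i → f (i ↑ˡ n) + f (n ↑ʳ i))
    ≡⟨ cong parity (∑-distrib-+ (λ i → f (i ↑ˡ n)) (λ i → f (n ↑ʳ i))) ⟩
  parity (sum (λ i → f (i ↑ˡ n)) + sum (λ i → f (n ↑ʳ i)))
    ≡⟨ cong parity (sym (sum-↑ˡ-↑ʳ n n f)) ⟩
  parity (sum f)
    ∎

hookedSkolemGraceful-nK₂⇒parity : ∀ n k d .{{_ : NonZero d}} →
  HookedSkolemGraceful k d (nK₂ (suc n)) →
  progressionParity (parity k) (parity d) (suc n) ≡ parity (suc n) ⁻¹
hookedSkolemGraceful-nK₂⇒parity n k d (f , vertexBijective , edgeBijective) = begin
  progressionParity (parity k) (parity d) (suc n)
    ≡⟨ parity-sum-progression k d (suc n) ⟨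
  parity (sum {suc n} λ i → k + toℕ i * d)
    ≡⟨ cong parity (sum-bijectiveOnto (progression-bijectiveOnto k d (suc n)) edgeBijective) ⟩
  parity (sum (edgeLabel (nK₂ (suc n)) f))
    ≡⟨ parity-sum-edgeLabel-nK₂ (suc n) f ⟩
  parity (sum {suc n + suc n} f)
    ≡⟨ cong parity (sum-bijectiveOnto vertexBijective (hookedLabel-bijectiveOnto (n + suc n))) ⟩
  parity (sum {suc n + suc n} (hookedLabel (suc n + suc n) ∘ toℕ))
    ≡⟨ parity-sum-hookedLabel n ⟩
  parity (suc n) ⁻¹
    ∎

mainTheorem2 : (n k d : ℕ) → 0 < n → 0 < k → 0 < d →
    HookedSkolemGraceful k d (nK₂ n) →
      (n % 4 ≡ 1 → 2 ∣ k)
    × (n % 4 ≡ 2 → ¬ (2 ∣ d))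
    × (n % 4 ≡ 3 → (2 ∣ k × 2 ∣ d) ⊎ (¬ (2 ∣ k) × ¬ (2 ∣ d)))
mainTheorem2 (suc n) k (suc d) _ _ _ graceful =
    (λ n%4≡1 → parity≡0ℙ⇒2∣ (progressionParity-1 a b (condition n%4≡1)))
  , (λ n%4≡2 → parity≡1ℙ⇒2∤ (progressionParity-2 a b (condition n%4≡2)))
  , (λ n%4≡3 → sameParity⇒2∣⊎2∤ (progressionParity-3 a b (condition n%4≡3)))
  where
  a = parity k
  b = parity (suc d)
  condition : ∀ {r} → suc n % 4 ≡ r → progressionParity a b r ≡ parity r ⁻¹
  condition refl = begin
    progressionParity a b (suc n % 4)  ≡⟨ periodic⇒≡% 4 (progressionParity a b) (progressionParity-periodic a b) (suc n) ⟨
    progressionParity a b (suc n)      ≡⟨ hookedSkolemGraceful-nK₂⇒parity n k (suc d) graceful ⟩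
    parity (suc n) ⁻¹                  ≡⟨ periodic⇒≡% 4 (_⁻¹ ∘ parity) (λ _ → refl) (suc n) ⟩
    parity (suc n % 4) ⁻¹              ∎
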